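{- Consider the PDSTSP setting described in the context. For every subset $S \subseteq V_c$ with $|S| \geq 3$, every feasible PDSTSP solution $(x,y)$ satisfies $$|S| \sum_{i, j \in S:\, i<j} x_{ij} \leq (|S|-1) \sum_{k \in S} y_k .$$
   Context: Parallel Drone Scheduling Traveling Salesman Problem (PDSTSP). There is a complete undirected graph $G=(V,E)$ with $V=\{0,1,\dots,n,n+1\}$ and $E=\{(i,j): i,j\in V,\ i<j\}$. Vertex $0$ is the depot and vertex $n+1$ is a copy of the depot. The customers are $V_c=\{1,\dots,n\}$. A subset $V_d\subseteq V_c$ consists of drone-eligible customers, and $V_t=V_c\setminus V_d$ are the customers that must be served by the truck. The variables are binary $x_{ij}$ for edges $(i,j)\in E$ (equal to 1 if the truck travels edge $(i,j)$) and binary $y_i$ for $i \in V$ (equal to 1 if vertex $i$ is visited by the truck), with $y_0=y_{n+1}=1$. Each customer with $y_i=0$ is served by one of the drones via back-and-forth trips from the depot; the drone variables are irrelevant here. A pair $(x,y)$ is a feasible PDSTSP solution if: $y_i=1$ for all $i\in V_t$; and $x$ is the incidence vector of the edge set of a simple path in $G$ from $0$ to $n+1$ whose interior vertices are exactly the customers $i\in V_c$ with $y_i=1$. In particular, every customer $j$ satisfies $\sum_{i<j}x_{ij}+\sum_{k>j}x_{jk}=2y_j$. -}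

module Defs where

open import Data.Nat using (ℕ; zero; suc; _+_; _*_; _∸_; _≤_)
open import Data.Bool using (Bool; true; false; if_then_else_)
open import Data.Fin using (Fin; fromℕ; _<_; _<?_) renaming (zero to fzero)
open import Data.Fin.Subset using (Subset; _∈_; ∣_∣)
open import Data.Fin.Subset.Properties using (_∈?_)
open import Data.List using (List; _∷_; []; _++_; [_])
open import Data.List.Relation.Unary.Unique.Propositional using (Unique)
import Data.List.Membership.Propositional as LM
open import Data.Product using (Σ; _×_; ∃; ∃-syntax)
open import Data.Sum using (_⊎_)
open import Relation.Binary.PropositionalEquality using (_≡_; _≢_)
open import Relation.Nullary using (¬_; Dec; yes; no)
open import Function.Bundles using (_⇔_)

-- Vertex set V = {0, 1, ..., n, n+1} as Fin (2 + n).
Vertex : ℕ → Set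
Vertex n = Fin (suc (suc n))

depot : ∀ {n} → Vertex n
depot = fzero

-- the copy n+1 of the depot
depot′ : ∀ {n} → Vertex n
depot′ {n} = fromℕ (suc n)

IsCustomer : ∀ {n} → Vertex n → Set
IsCustomer {n} v = (v ≢ depot) × (v ≢ depot′ {n})

b2n : Bool → ℕ
b2n true  = 1
b2n false = 0

sumFin : ∀ {m} → (Fin m → ℕ) → ℕ
sumFin {zero}  f = 0
sumFin {suc m} f = f fzero + sumFin (λ i → f (Data.Fin.suc i))

Consecutive : ∀ {A : Set} → List A → A → A → Set
Consecutive p a b = ∃[ pre ] ∃[ suf ] (p ≡ pre ++ a ∷ b ∷ suf)

-- Feasible PDSTSP solution (x, y) for drone-eligible set Vd.
-- x i j is only meaningful for i < j (edges of E).
record Feasible (n : ℕ) (Vd : Subset (suc (suc n)))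
                (x : Vertex n → Vertex n → Bool) (y : Vertex n → Bool) : Set where
  field
    y-depot   : y depot ≡ true
    y-depot′  : y (depot′ {n}) ≡ true
    y-truck   : ∀ i → IsCustomer {n} i → ¬ (i ∈ Vd) → y i ≡ true
    mid       : List (Vertex n)
    simple    : Unique (depot ∷ mid ++ [ depot′ {n} ])
    interior  : ∀ v → (v LM.∈ mid) ⇔ (IsCustomer {n} v × y v ≡ true)
    incidence : ∀ i j → i < j →
                  (x i j ≡ true) ⇔
                  (Consecutive (depot ∷ mid ++ [ depot′ {n} ]) i j
                   ⊎ Consecutive (depot ∷ mid ++ [ depot′ {n} ]) j i)

edgeSumIn : ∀ {n} → Subset (suc (suc n)) → (Vertex n → Vertex n → Bool) → ℕ
edgeSumIn {n} S x = sumFin λ i → sumFin λ j → term i j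
  where
  term : Vertex n → Vertex n → ℕ
  term i j with i ∈? S | j ∈? S | i <? j
  ... | yes _ | yes _ | yes _ = b2n (x i j)
  ... | _     | _     | _     = 0

vertexSumIn : ∀ {n} → Subset (suc (suc n)) → (Vertex n → Bool) → ℕ
vertexSumIn {n} S y = sumFin λ k → term k
  where
  term : Vertex n → ℕ
  term k with k ∈? S
  ... | yes _ = b2n (y k)
  ... | no _  = 0

{-# OPTIONS --safe #-}
-- The truck route is a simple path, so an edge of it with both ends in S joins
-- two entries of S that are consecutive along the path. If the path meets S in
-- k vertices there are at most k − 1 such edges, and since S consists of
-- customers, k is exactly the number of elements of S with y = 1. Hence
-- Σ x ≤ Σ y − 1, and with Σ y ≤ |S| this gives |S| Σ x ≤ |S| (Σ y − 1) ≤ (|S| − 1) Σ y.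
module Submission where

open import Defs
open import Data.Nat using (ℕ; suc; _*_; _∸_; _≤_)
open import Data.Bool using (Bool)
open import Data.Fin.Subset using (Subset; _∈_; _⊆_; ∣_∣)

open import Data.Nat using (zero; _+_; z≤n; s≤s)
open import Data.Nat.Properties
  using (≤-refl; ≤-trans; +-mono-≤; m≤n+m; m∸n≤m; ∸-monoˡ-≤; ∸-monoʳ-≤;
         *-monoʳ-≤; *-distribˡ-∸; *-distribʳ-∸; *-distribˡ-+; *-identityˡ; *-identityʳ;
         *-zeroʳ; +-identityʳ; +-commutativeSemigroup; module ≤-Reasoning)
open import Algebra.Properties.CommutativeSemigroup +-commutativeSemigroup
  using () renaming (interchange to +-interchange)
open import Data.Bool using (true; false)
open import Data.Empty using (⊥-elim)
open import Data.List using (List; []; _∷_; _++_; [_]; length)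
open import Data.List.Relation.Unary.Any using (here; there)
open import Data.List.Relation.Unary.All using (All; []; _∷_)
open import Data.List.Relation.Unary.AllPairs using ([]; _∷_)
open import Data.List.Relation.Unary.Unique.Propositional using (Unique)
open import Data.List.Membership.Propositional using () renaming (_∈_ to _∈ₗ_)
open import Data.List.Membership.Propositional.Properties using (∈-++⁻)
open import Data.Fin using (Fin; _<_; _<?_; _≟_) renaming (zero to fzero; suc to fsuc)
open import Data.Fin.Properties using (<-asym)
open import Data.Fin.Subset.Properties using (_∈?_)
open import Data.Product using (_×_; _,_; proj₁; proj₂)
open import Data.Sum using (inj₁; inj₂)
open import Data.Vec using (here; there) renaming (_∷_ to _∷ᵛ_; [] to []ᵛ)
open import Function.Bundles using (Equivalence)
open import Relation.Nullary using (yes; no; ¬_; Dec)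
open import Relation.Binary.PropositionalEquality
  using (_≡_; _≢_; refl; sym; trans; cong; cong₂; subst; module ≡-Reasoning)

sumFin-cong : ∀ {m} {f g : Fin m → ℕ} → (∀ i → f i ≡ g i) → sumFin f ≡ sumFin g
sumFin-cong {zero}  f≡g = refl
sumFin-cong {suc m} f≡g = cong₂ _+_ (f≡g fzero) (sumFin-cong (λ i → f≡g (fsuc i)))

sumFin-mono-≤ : ∀ {m} {f g : Fin m → ℕ} → (∀ i → f i ≤ g i) → sumFin f ≤ sumFin g
sumFin-mono-≤ {zero}  f≤g = z≤n
sumFin-mono-≤ {suc m} f≤g = +-mono-≤ (f≤g fzero) (sumFin-mono-≤ (λ i → f≤g (fsuc i)))

sumFin-≡0 : ∀ {m} {f : Fin m → ℕ} → (∀ i → f i ≡ 0) → sumFin f ≡ 0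
sumFin-≡0 {zero}  f≡0 = refl
sumFin-≡0 {suc m} f≡0 = cong₂ _+_ (f≡0 fzero) (sumFin-≡0 (λ i → f≡0 (fsuc i)))

sumFin-distrib-+ : ∀ {m} (f g : Fin m → ℕ) → sumFin (λ i → f i + g i) ≡ sumFin f + sumFin g
sumFin-distrib-+ {zero}  f g = refl
sumFin-distrib-+ {suc m} f g =
  trans (cong (f fzero + g fzero +_) (sumFin-distrib-+ (λ i → f (fsuc i)) (λ i → g (fsuc i))))
        (+-interchange (f fzero) (g fzero) _ _)

sumFin≤∣∣ : ∀ {m} (S : Subset m) {f : Fin m → ℕ} →
            (∀ v → f v ≤ 1) → (∀ v → ¬ v ∈ S → f v ≡ 0) → sumFin f ≤ ∣ S ∣
sumFin≤∣∣ []ᵛ            f≤1 f≡0 = z≤n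
sumFin≤∣∣ (true ∷ᵛ S)  f≤1 f≡0 =
  +-mono-≤ (f≤1 fzero) (sumFin≤∣∣ S (λ v → f≤1 (fsuc v)) (λ v v∉S → f≡0 (fsuc v) (λ { (there v∈S) → v∉S v∈S })))
sumFin≤∣∣ (false ∷ᵛ S) f≤1 f≡0 rewrite f≡0 fzero (λ ()) =
  sumFin≤∣∣ S (λ v → f≤1 (fsuc v)) (λ v v∉S → f≡0 (fsuc v) (λ { (there v∈S) → v∉S v∈S }))

δ : ∀ {m} → Fin m → Fin m → ℕ
δ fzero    fzero    = 1
δ fzero    (fsuc _) = 0
δ (fsuc _) fzero    = 0
δ (fsuc i) (fsuc j) = δ i j

δ-refl : ∀ {m} (i : Fin m) → δ i i ≡ 1
δ-refl fzero    = refl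
δ-refl (fsuc i) = δ-refl i

δ-≢ : ∀ {m} {i j : Fin m} → i ≢ j → δ i j ≡ 0
δ-≢ {i = fzero}  {fzero}  i≢j = ⊥-elim (i≢j refl)
δ-≢ {i = fzero}  {fsuc j} i≢j = refl
δ-≢ {i = fsuc i} {fzero}  i≢j = refl
δ-≢ {i = fsuc i} {fsuc j} i≢j = δ-≢ (λ i≡j → i≢j (cong fsuc i≡j))

sumFin-*δ : ∀ {m} (g : Fin m → ℕ) (a : Fin m) → sumFin (λ v → g v * δ v a) ≡ g a
sumFin-*δ {suc m} g fzero = begin
  g fzero * 1 + sumFin (λ v → g (fsuc v) * 0)  ≡⟨ cong₂ _+_ (*-identityʳ (g fzero)) (sumFin-≡0 (λ v → *-zeroʳ (g (fsuc v)))) ⟩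
  g fzero + 0                                   ≡⟨ +-identityʳ (g fzero) ⟩
  g fzero                                       ∎
  where open ≡-Reasoning
sumFin-*δ {suc m} g (fsuc a) =
  trans (cong (_+ sumFin (λ v → g (fsuc v) * δ v a)) (*-zeroʳ (g fzero))) (sumFin-*δ (λ v → g (fsuc v)) a)

sumFin-δ : ∀ {m} (a : Fin m) → sumFin (λ v → δ v a) ≡ 1
sumFin-δ a = trans (sumFin-cong (λ v → sym (*-identityˡ (δ v a)))) (sumFin-*δ (λ _ → 1) a)

occurrences : ∀ {m} → Fin m → List (Fin m) → ℕ
occurrences v []      = 0
occurrences v (a ∷ l) = δ v a + occurrences v l

occurrences-∉ : ∀ {m} {v : Fin m} {l} → All (v ≢_) l → occurrences v l ≡ 0
occurrences-∉ []            = refl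
occurrences-∉ (v≢a ∷ v∉l) = cong₂ _+_ (δ-≢ v≢a) (occurrences-∉ v∉l)

occurrences≤1 : ∀ {m} (v : Fin m) {l} → Unique l → occurrences v l ≤ 1
occurrences≤1 v []                  = z≤n
occurrences≤1 v {a ∷ l} (a∉l ∷ l!) with v ≟ a
... | yes refl rewrite δ-refl v | occurrences-∉ a∉l = ≤-refl
... | no v≢a   rewrite δ-≢ v≢a = occurrences≤1 v l!

occurrences>0⇒∈ : ∀ {m} (v : Fin m) l → 1 ≤ occurrences v l → v ∈ₗ l
occurrences>0⇒∈ v (a ∷ l) 1≤occ with v ≟ a
... | yes v≡a = here v≡a
... | no v≢a rewrite δ-≢ v≢a = there (occurrences>0⇒∈ v l 1≤occ)

occurrences≤b2n : ∀ {m} (v : Fin m) {l} b → Unique l → (v ∈ₗ l → b ≡ true) → occurrences v l ≤ b2n b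
occurrences≤b2n v     true  l! _ = occurrences≤1 v l!
occurrences≤b2n v {l} false l! v∈l⇒b with occurrences v l in occ≡
... | zero  = z≤n
... | suc _ with v∈l⇒b (occurrences>0⇒∈ v l (subst (1 ≤_) (sym occ≡) (s≤s z≤n)))
...   | ()

pairOccurrences : ∀ {m} → Fin m → Fin m → List (Fin m × Fin m) → ℕ
pairOccurrences i j []            = 0
pairOccurrences i j ((a , b) ∷ L) = δ i a * δ j b + pairOccurrences i j L

sumFin-pairOccurrences : ∀ {m} (L : List (Fin m × Fin m)) →
  sumFin (λ i → sumFin (λ j → pairOccurrences i j L)) ≡ length L
sumFin-pairOccurrences {m} [] = sumFin-≡0 (λ i → sumFin-≡0 {m} {λ j → pairOccurrences i j []} (λ j → refl))
sumFin-pairOccurrences ((a , b) ∷ L) = begin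
  sumFin (λ i → sumFin (λ j → δ i a * δ j b + pairOccurrences i j L))
    ≡⟨ sumFin-cong (λ i → sumFin-distrib-+ (λ j → δ i a * δ j b) (λ j → pairOccurrences i j L)) ⟩
  sumFin (λ i → sumFin (λ j → δ i a * δ j b) + sumFin (λ j → pairOccurrences i j L))
    ≡⟨ sumFin-distrib-+ (λ i → sumFin (λ j → δ i a * δ j b)) (λ i → sumFin (λ j → pairOccurrences i j L)) ⟩
  sumFin (λ i → sumFin (λ j → δ i a * δ j b)) + sumFin (λ i → sumFin (λ j → pairOccurrences i j L))
    ≡⟨ cong₂ _+_ (trans (sumFin-cong (λ i → sumFin-*δ (λ _ → δ i a) b)) (sumFin-δ a)) (sumFin-pairOccurrences L) ⟩
  suc (length L)
    ∎
  where open ≡-Reasoning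

∈⇒pairOccurrences>0 : ∀ {m} {a b : Fin m} {L} → (a , b) ∈ₗ L → 1 ≤ pairOccurrences a b L
∈⇒pairOccurrences>0 {a = a} {b} (here refl) rewrite δ-refl a | δ-refl b = s≤s z≤n
∈⇒pairOccurrences>0 {a = a} {b} {(c , d) ∷ L} (there ab∈L) =
  ≤-trans (∈⇒pairOccurrences>0 ab∈L) (m≤n+m _ (δ a c * δ b d))

module _ {m} (S : Subset m) where

  indicator : Fin m → ℕ
  indicator v with v ∈? S
  ... | yes _ = 1
  ... | no _  = 0

  countIn : List (Fin m) → ℕ
  countIn []      = 0
  countIn (a ∷ l) = indicator a + countIn l

  ordered : Fin m → Fin m → Fin m × Fin m
  ordered a b with a <? b
  ... | yes _ = a , b
  ... | no _  = b , a

  ordered-< : ∀ {a b} → a < b → ordered a b ≡ (a , b)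
  ordered-< {a} {b} a<b with a <? b
  ... | yes _  = refl
  ... | no a≮b = ⊥-elim (a≮b a<b)

  ordered-> : ∀ {a b} → a < b → ordered b a ≡ (a , b)
  ordered-> {a} {b} a<b with b <? a
  ... | yes b<a = ⊥-elim (<-asym a<b b<a)
  ... | no _    = refl

  innerEdgesFrom : Fin m → List (Fin m) → List (Fin m × Fin m)
  innerEdgesFrom a []      = []
  innerEdgesFrom a (b ∷ l) with a ∈? S | b ∈? S
  ... | yes _ | yes _ = ordered a b ∷ innerEdgesFrom b l
  ... | _     | _     = innerEdgesFrom b l

  innerEdges : List (Fin m) → List (Fin m × Fin m)
  innerEdges []      = []
  innerEdges (a ∷ l) = innerEdgesFrom a l

  length-innerEdges : ∀ l → length (innerEdges l) ≤ countIn l ∸ 1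
  length-innerEdges []       = z≤n
  length-innerEdges (a ∷ []) = z≤n
  length-innerEdges (a ∷ b ∷ l) with a ∈? S | b ∈? S | length-innerEdges (b ∷ l)
  ... | yes _ | yes _ | ih = s≤s ih
  ... | yes _ | no _  | ih = ≤-trans ih (m∸n≤m _ 1)
  ... | no _  | _     | ih = ih

  innerEdges-∷ : ∀ {e} c l → e ∈ₗ innerEdges l → e ∈ₗ innerEdges (c ∷ l)
  innerEdges-∷ c (d ∷ l) e∈ with c ∈? S | d ∈? S
  ... | yes _ | yes _ = there e∈
  ... | yes _ | no _  = e∈
  ... | no _  | _     = e∈

  consecutive⇒∈innerEdges : ∀ {a b l} → a ∈ S → b ∈ S → Consecutive l a b →
                             ordered a b ∈ₗ innerEdges l
  consecutive⇒∈innerEdges {a} {b} a∈S b∈S ([] , suf , refl) with a ∈? S | b ∈? S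
  ... | yes _   | yes _   = here refl
  ... | yes _   | no b∉S = ⊥-elim (b∉S b∈S)
  ... | no a∉S | _       = ⊥-elim (a∉S a∈S)
  consecutive⇒∈innerEdges a∈S b∈S (c ∷ pre , suf , refl) =
    innerEdges-∷ c (pre ++ _ ∷ _ ∷ suf) (consecutive⇒∈innerEdges a∈S b∈S (pre , suf , refl))

  countIn-occurrences : ∀ l → countIn l ≡ sumFin (λ v → indicator v * occurrences v l)
  countIn-occurrences []      = sym (sumFin-≡0 (λ v → *-zeroʳ (indicator v)))
  countIn-occurrences (a ∷ l) = sym (begin
    sumFin (λ v → indicator v * (δ v a + occurrences v l))
      ≡⟨ sumFin-cong (λ v → *-distribˡ-+ (indicator v) (δ v a) (occurrences v l)) ⟩
    sumFin (λ v → indicator v * δ v a + indicator v * occurrences v l)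
      ≡⟨ sumFin-distrib-+ (λ v → indicator v * δ v a) (λ v → indicator v * occurrences v l) ⟩
    sumFin (λ v → indicator v * δ v a) + sumFin (λ v → indicator v * occurrences v l)
      ≡⟨ cong₂ _+_ (sumFin-*δ indicator a) (sym (countIn-occurrences l)) ⟩
    indicator a + countIn l
      ∎)
    where open ≡-Reasoning

edgeTerm : ∀ {m} → Subset m → (Fin m → Fin m → Bool) → Fin m → Fin m → ℕ
edgeTerm S x i j with i ∈? S | j ∈? S | i <? j
... | yes _ | yes _ | yes _ = b2n (x i j)
... | _     | _     | _     = 0

vertexTerm : ∀ {m} → Subset m → (Fin m → Bool) → Fin m → ℕ
vertexTerm S y v with v ∈? S
... | yes _ = b2n (y v)
... | no _  = 0

edgeTerm-≮ : ∀ {m} (S : Subset m) x i j → ¬ i < j → edgeTerm S x i j ≡ 0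
edgeTerm-≮ S x i j i≮j with i ∈? S | j ∈? S | i <? j
... | yes _ | yes _ | yes i<j = ⊥-elim (i≮j i<j)
... | yes _ | yes _ | no _    = refl
... | yes _ | no _  | _       = refl
... | no _  | _     | _       = refl

b2n≤1 : ∀ b → b2n b ≤ 1
b2n≤1 true  = ≤-refl
b2n≤1 false = z≤n

vertexTerm≤1 : ∀ {m} (S : Subset m) y v → vertexTerm S y v ≤ 1
vertexTerm≤1 S y v with v ∈? S
... | yes _ = b2n≤1 (y v)
... | no _  = z≤n

vertexTerm-∉ : ∀ {m} (S : Subset m) y {v} → ¬ v ∈ S → vertexTerm S y v ≡ 0
vertexTerm-∉ S y {v} v∉S with v ∈? S
... | yes v∈S = ⊥-elim (v∉S v∈S)
... | no _    = refl

vertexSum≤∣∣ : ∀ {m} (S : Subset m) y → sumFin (vertexTerm S y) ≤ ∣ S ∣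
vertexSum≤∣∣ S y = sumFin≤∣∣ S (vertexTerm≤1 S y) (λ v → vertexTerm-∉ S y)

-- Defs hides the summands of edgeSumIn and vertexSumIn in where-blocks. The
-- definitions with right-hand side _ name them: each is solved by unification
-- against the unfolding of the sums in the refl proofs below. As Vertex n has
-- two fixed elements, sumFin unfolds indices 0 and 1; row 0 vanishes because the
-- depot is not in S, and row 1 depends on the bit s.
mutual
  edgeRow₁ : ∀ {n} → Bool → Subset n → (Vertex n → Vertex n → Bool) → Fin n → ℕ
  edgeRow₁ true  S x j = _
  edgeRow₁ false S x j = 0

  edgeRow : ∀ {n} → Bool → Subset n → (Vertex n → Vertex n → Bool) → Fin n → ℕ
  edgeRow true  S x i = _
  edgeRow false S x i = _

  edgeCell : ∀ {n} s (S : Subset n) → (Vertex n → Vertex n → Bool) →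
             (i : Fin n) → fsuc (fsuc i) ∈ (false ∷ᵛ s ∷ᵛ S) → Fin n → ℕ
  edgeCell true  S x i i∈S j = _
  edgeCell false S x i i∈S j = _

  edgeCells : ∀ {n} s (S : Subset n) → (Vertex n → Vertex n → Bool) →
              (i : Fin n) → Dec (fsuc (fsuc i) ∈ (false ∷ᵛ s ∷ᵛ S)) → Fin n → ℕ
  edgeCells s S x i (yes i∈S) = edgeCell s S x i i∈S
  edgeCells s S x i (no _)    = λ _ → 0

  vertexCell : ∀ {n} → Bool → Subset n → (Vertex n → Bool) → Fin n → ℕ
  vertexCell true  S y k = _
  vertexCell false S y k = _

  edgeSumIn-rows : ∀ {n} s (S : Subset n) x →
    edgeSumIn (false ∷ᵛ s ∷ᵛ S) x ≡
      sumFin (λ (_ : Fin n) → 0) + (sumFin (edgeRow₁ s S x) + sumFin (edgeRow s S x))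
  edgeSumIn-rows true  S x = refl
  edgeSumIn-rows false S x = refl

  edgeRow-cells : ∀ {n} s (S : Subset n) x i →
    edgeRow s S x i ≡ sumFin (edgeCells s S x i (fsuc (fsuc i) ∈? (false ∷ᵛ s ∷ᵛ S)))
  edgeRow-cells true S x i with fsuc (fsuc i) ∈? (false ∷ᵛ true ∷ᵛ S)
  ... | yes _ = refl
  ... | no _  = refl
  edgeRow-cells false S x i with fsuc (fsuc i) ∈? (false ∷ᵛ false ∷ᵛ S)
  ... | yes _ = refl
  ... | no _  = refl

  vertexSumIn-cells : ∀ {n} s (S : Subset n) y →
    vertexSumIn (false ∷ᵛ s ∷ᵛ S) y ≡
      vertexTerm (false ∷ᵛ s ∷ᵛ S) y (fsuc fzero) + sumFin (vertexCell s S y)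
  vertexSumIn-cells true  S y = refl
  vertexSumIn-cells false S y = refl

edgeRow₁-edgeTerm : ∀ {n} s (S : Subset n) x →
  sumFin (edgeRow₁ s S x) ≡ sumFin (edgeTerm (false ∷ᵛ s ∷ᵛ S) x (fsuc fzero))
edgeRow₁-edgeTerm true S x = sumFin-cong cell
  where
  cell : ∀ j → edgeRow₁ true S x j ≡ edgeTerm (false ∷ᵛ true ∷ᵛ S) x (fsuc fzero) (fsuc (fsuc j))
  cell j with j ∈? S
  ... | yes _ = refl
  ... | no _  = refl
edgeRow₁-edgeTerm false S x = refl

edgeCells-edgeTerm : ∀ {n} s (S : Subset n) x i j →
  edgeCells s S x i (fsuc (fsuc i) ∈? (false ∷ᵛ s ∷ᵛ S)) j ≡
    edgeTerm (false ∷ᵛ s ∷ᵛ S) x (fsuc (fsuc i)) (fsuc (fsuc j))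
edgeCells-edgeTerm true S x i j with fsuc (fsuc i) ∈? (false ∷ᵛ true ∷ᵛ S)
... | no _  = refl
... | yes _ with j ∈? S | fsuc (fsuc i) <? fsuc (fsuc j)
...   | yes _ | yes _ = refl
...   | yes _ | no _  = refl
...   | no _  | _     = refl
edgeCells-edgeTerm false S x i j with fsuc (fsuc i) ∈? (false ∷ᵛ false ∷ᵛ S)
... | no _  = refl
... | yes _ with j ∈? S | fsuc (fsuc i) <? fsuc (fsuc j)
...   | yes _ | yes _ = refl
...   | yes _ | no _  = refl
...   | no _  | _     = refl

vertexCell-vertexTerm : ∀ {n} s (S : Subset n) y k →
  vertexCell s S y k ≡ vertexTerm (false ∷ᵛ s ∷ᵛ S) y (fsuc (fsuc k))
vertexCell-vertexTerm true S y k with k ∈? S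
... | yes _ = refl
... | no _  = refl
vertexCell-vertexTerm false S y k with k ∈? S
... | yes _ = refl
... | no _  = refl

edgeRow-edgeTerm : ∀ {n} s (S : Subset n) x i →
  edgeRow s S x i ≡ sumFin (edgeTerm (false ∷ᵛ s ∷ᵛ S) x (fsuc (fsuc i)))
edgeRow-edgeTerm s S x i = begin
  edgeRow s S x i
    ≡⟨ edgeRow-cells s S x i ⟩
  sumFin (edgeCells s S x i (fsuc (fsuc i) ∈? S′))
    ≡⟨ sumFin-cong (edgeCells-edgeTerm s S x i) ⟩
  sumFin (λ j → edgeTerm S′ x (fsuc (fsuc i)) (fsuc (fsuc j)))
    ≡⟨ sym (cong₂ _+_ (edgeTerm-≮ S′ x (fsuc (fsuc i)) fzero λ ())
                      (cong₂ _+_ (edgeTerm-≮ S′ x (fsuc (fsuc i)) (fsuc fzero) λ { (s≤s ()) }) refl)) ⟩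
  sumFin (edgeTerm S′ x (fsuc (fsuc i)))
    ∎
  where
  open ≡-Reasoning
  S′ = false ∷ᵛ s ∷ᵛ S

edgeSumIn-edgeTerm : ∀ {n} s (S : Subset n) x →
  edgeSumIn (false ∷ᵛ s ∷ᵛ S) x ≡ sumFin (λ i → sumFin (edgeTerm (false ∷ᵛ s ∷ᵛ S) x i))
edgeSumIn-edgeTerm {n} s S x = trans (edgeSumIn-rows s S x)
  (cong (sumFin (λ (_ : Fin n) → 0) +_)
        (cong₂ _+_ (edgeRow₁-edgeTerm s S x) (sumFin-cong (edgeRow-edgeTerm s S x))))

vertexSumIn-vertexTerm : ∀ {n} s (S : Subset n) y →
  vertexSumIn (false ∷ᵛ s ∷ᵛ S) y ≡ sumFin (vertexTerm (false ∷ᵛ s ∷ᵛ S) y)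
vertexSumIn-vertexTerm s S y =
  trans (vertexSumIn-cells s S y)
        (cong (vertexTerm (false ∷ᵛ s ∷ᵛ S) y (fsuc fzero) +_) (sumFin-cong (vertexCell-vertexTerm s S y)))

module _ {n Vd x y} (F : Feasible n Vd x y) where
  open Feasible F

  path : List (Vertex n)
  path = depot ∷ mid ++ [ depot′ {n} ]

  y-on-path : ∀ {v} → IsCustomer {n} v → v ∈ₗ path → y v ≡ true
  y-on-path v∈Vc (here v≡0) = ⊥-elim (proj₁ v∈Vc v≡0)
  y-on-path {v} v∈Vc (there v∈) with ∈-++⁻ mid v∈
  ... | inj₁ v∈mid        = proj₂ (Equivalence.to (interior v) v∈mid)
  ... | inj₂ (here v≡n+1) = ⊥-elim (proj₂ v∈Vc v≡n+1)

  edgeTerm≤pairOccurrences : ∀ S i j → edgeTerm S x i j ≤ pairOccurrences i j (innerEdges S path)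
  edgeTerm≤pairOccurrences S i j with i ∈? S | j ∈? S | i <? j
  ... | no _    | _       | _       = z≤n
  ... | yes _   | no _    | _       = z≤n
  ... | yes _   | yes _   | no _    = z≤n
  ... | yes i∈S | yes j∈S | yes i<j with x i j in xᵢⱼ≡true
  ...   | false = z≤n
  ...   | true with Equivalence.to (incidence i j i<j) xᵢⱼ≡true
  ...     | inj₁ i→j = ∈⇒pairOccurrences>0
              (subst (_∈ₗ innerEdges S path) (ordered-< S i<j) (consecutive⇒∈innerEdges S i∈S j∈S i→j))
  ...     | inj₂ j→i = ∈⇒pairOccurrences>0
              (subst (_∈ₗ innerEdges S path) (ordered-> S i<j) (consecutive⇒∈innerEdges S j∈S i∈S j→i))

  module _ {S} (customers : ∀ v → v ∈ S → IsCustomer {n} v) where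

    indicator*occurrences≤vertexTerm : ∀ v → indicator S v * occurrences v path ≤ vertexTerm S y v
    indicator*occurrences≤vertexTerm v with v ∈? S
    ... | no _    = z≤n
    ... | yes v∈S = subst (_≤ b2n (y v)) (sym (*-identityˡ (occurrences v path)))
                      (occurrences≤b2n v (y v) simple (y-on-path (customers v v∈S)))

    edgeSum≤vertexSum∸1 : sumFin (λ i → sumFin (edgeTerm S x i)) ≤ sumFin (vertexTerm S y) ∸ 1
    edgeSum≤vertexSum∸1 = begin
      sumFin (λ i → sumFin (edgeTerm S x i))
        ≤⟨ sumFin-mono-≤ (λ i → sumFin-mono-≤ (edgeTerm≤pairOccurrences S i)) ⟩
      sumFin (λ i → sumFin (λ j → pairOccurrences i j (innerEdges S path)))
        ≡⟨ sumFin-pairOccurrences (innerEdges S path) ⟩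
      length (innerEdges S path)
        ≤⟨ length-innerEdges S path ⟩
      countIn S path ∸ 1
        ≡⟨ cong (_∸ 1) (countIn-occurrences S path) ⟩
      sumFin (λ v → indicator S v * occurrences v path) ∸ 1
        ≤⟨ ∸-monoˡ-≤ 1 (sumFin-mono-≤ indicator*occurrences≤vertexTerm) ⟩
      sumFin (vertexTerm S y) ∸ 1
        ∎
      where open ≤-Reasoning

s*e≤[s∸1]*v : ∀ s e v → e ≤ v ∸ 1 → v ≤ s → s * e ≤ (s ∸ 1) * v
s*e≤[s∸1]*v s e v e≤v∸1 v≤s = begin
  s * e          ≤⟨ *-monoʳ-≤ s e≤v∸1 ⟩
  s * (v ∸ 1)    ≡⟨ *-distribˡ-∸ s v 1 ⟩
  s * v ∸ s * 1  ≡⟨ cong (s * v ∸_) (*-identityʳ s) ⟩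
  s * v ∸ s      ≤⟨ ∸-monoʳ-≤ (s * v) v≤s ⟩
  s * v ∸ v      ≡⟨ cong (s * v ∸_) (sym (*-identityˡ v)) ⟩
  s * v ∸ 1 * v  ≡⟨ *-distribʳ-∸ v s 1 ⟨
  (s ∸ 1) * v    ∎
  where open ≤-Reasoning

proposition2 : (n : ℕ) (Vd : Subset (suc (suc n))) →
    (∀ v → v ∈ Vd → IsCustomer {n} v) →
    (x : Vertex n → Vertex n → Bool) (y : Vertex n → Bool) →
    Feasible n Vd x y →
    (S : Subset (suc (suc n))) →
    (∀ v → v ∈ S → IsCustomer {n} v) →
    3 ≤ ∣ S ∣ →
    ∣ S ∣ * edgeSumIn S x ≤ (∣ S ∣ ∸ 1) * vertexSumIn S y
proposition2 n Vd _ x y F (true ∷ᵛ S) customers _ = ⊥-elim (proj₁ (customers fzero here) refl)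
proposition2 n Vd _ x y F (false ∷ᵛ s ∷ᵛ S) customers _
  rewrite edgeSumIn-edgeTerm s S x | vertexSumIn-vertexTerm s S y =
  s*e≤[s∸1]*v _ _ _ (edgeSum≤vertexSum∸1 F customers) (vertexSum≤∣∣ (false ∷ᵛ s ∷ᵛ S) y)
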